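{- Let $M$ be a structure, $\mathcal{E}$ a family of quantifier-free definable equivalence relations on $M$, and $M^{\mathcal{E}}$ the expansion described in the context. Then for all finite tuples $\bar a,\bar b$ from $M$ and all ordinals $\alpha$, $(M,\bar a)\equiv_\alpha(M,\bar b)$ if and only if $(M^{\mathcal{E}},\bar a)\equiv_\alpha(M^{\mathcal{E}},\bar b)$.
   Context: $M^{\mathcal{E}}$ is the multi-sorted expansion of $M$ obtained by adding, for each $E\in\mathcal{E}$, a new sort $U_E$ (pairwise disjoint) and a projection function $\pi_E:M\to U_E$ such that for all $a,b\in M$, $M\models E(a,b)$ iff $\pi_E(a)=\pi_E(b)$; $U_E$ is identified with $M/E$. Back-and-forth relations: $(M,\bar a)\equiv_0(N,\bar b)$ iff $\bar a,\bar b$ have the same quantifier-free type; $(M,\bar a)\equiv_{\alpha+1}(N,\bar b)$ iff for every $a\in M$ there is $b\in N$ with $(M,\bar aa)\equiv_\alpha(N,\bar bb)$ and vice versa; for limit $\delta$, $\equiv_\delta$ means $\equiv_\alpha$ for all $\alpha<\delta$. -}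

module Defs where

open import Data.Nat using (ℕ; zero; suc)
open import Data.Unit using (⊤; tt)
open import Data.Empty using (⊥)
open import Data.Product using (_×_; _,_; ∃-syntax)
open import Data.Sum using (_⊎_)
open import Data.List using (List; []; _∷_; length; replicate)
open import Data.List.Relation.Unary.All using (All; []; _∷_)
open import Data.List.Membership.Propositional using (_∈_)
open import Data.List.Relation.Unary.Any using (here; there)
open import Data.Vec using (Vec; []; _∷_)
open import Relation.Binary.PropositionalEquality using (_≡_; refl)
open import Relation.Binary.Structures using (IsEquivalence)
open import Function.Bundles using (_⇔_)

-- The symbol "=" of sort s is interpreted by a relation _≈_ on the
-- carrier of sort s (this is how a quotient sort M/E is represented
-- without quotient types: carrier M, equality E).

record Signature : Set₁ where
  field
    Sort : Set
    Fun  : List Sort → Sort → Set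
    Rel  : List Sort → Set

module _ (Σ : Signature) where
  open Signature Σ

  record Structure : Set₁ where
    field
      car : Sort → Set
      eqv : ∀ {s} → car s → car s → Set
      fun : ∀ {ss s} → Fun ss s → All car ss → car s
      rel : ∀ {ss} → Rel ss → All car ss → Set

  mutual
    data Term (Γ : List Sort) : Sort → Set where
      var : ∀ {s} → s ∈ Γ → Term Γ s
      app : ∀ {ss s} → Fun ss s → Terms Γ ss → Term Γ s

    data Terms (Γ : List Sort) : List Sort → Set where
      []  : Terms Γ []
      _∷_ : ∀ {s ss} → Term Γ s → Terms Γ ss → Terms Γ (s ∷ ss)

  data Atomic (Γ : List Sort) : Set where
    equ : ∀ {s} → Term Γ s → Term Γ s → Atomic Γ
    rl  : ∀ {ss} → Rel ss → Terms Γ ss → Atomic Γ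

  data QF (Γ : List Sort) : Set where
    atom : Atomic Γ → QF Γ
    neg  : QF Γ → QF Γ
    conj : QF Γ → QF Γ → QF Γ
    disj : QF Γ → QF Γ → QF Γ

  module Sem (A : Structure) where
    open Structure A

    lookupEnv : ∀ {Γ s} → All car Γ → s ∈ Γ → car s
    lookupEnv (x ∷ _) (here refl) = x
    lookupEnv (_ ∷ xs) (there p) = lookupEnv xs p

    mutual
      eval : ∀ {Γ s} → Term Γ s → All car Γ → car s
      eval (var p) ρ = lookupEnv ρ p
      eval (app f ts) ρ = fun f (evals ts ρ)

      evals : ∀ {Γ ss} → Terms Γ ss → All car Γ → All car ss
      evals [] ρ = []
      evals (t ∷ ts) ρ = eval t ρ ∷ evals ts ρ

    SatA : ∀ {Γ} → Atomic Γ → All car Γ → Set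
    SatA (equ t u) ρ = eqv (eval t ρ) (eval u ρ)
    SatA (rl r ts) ρ = rel r (evals ts ρ)

    Sat : ∀ {Γ} → QF Γ → All car Γ → Set
    Sat (atom a) ρ = SatA a ρ
    Sat (neg φ) ρ = Sat φ ρ → ⊥
    Sat (conj φ ψ) ρ = Sat φ ρ × Sat ψ ρ
    Sat (disj φ ψ) ρ = Sat φ ρ ⊎ Sat ψ ρ

  Env : Structure → List Sort → Set
  Env A Γ = All (Structure.car A) Γ

  SameQFType : (A B : Structure) → ∀ {Γ} → Env A Γ → Env B Γ → Set
  SameQFType A B {Γ} a b = (φ : QF Γ) → Sem.Sat A φ a ⇔ Sem.Sat B φ b

-- Ordinals as Brouwer trees with limits over arbitrary (inhabited)
-- index types in Set: zero, successor, and supremum of a family.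

data Ord : Set₁ where
  ozero : Ord
  osuc  : Ord → Ord
  olim  : (I : Set) → I → (I → Ord) → Ord

-- Back-and-forth relations  (A, a) ≡_α (B, b).
-- In the limit case: ≡_(sup f) holds iff ≡_(f i) holds for all i
-- (equivalently ≡_β for all β < sup f, as ≡_β decreases in β).
BF : (Σ : Signature) → Ord → (A B : Structure Σ) → ∀ {Γ}
   → Env Σ A Γ → Env Σ B Γ → Set
BF Σ ozero A B a b = SameQFType Σ A B a b
BF Σ (osuc α) A B a b =
    (∀ s (x : Structure.car A s) → ∃[ y ] BF Σ α A B (x ∷ a) (y ∷ b))
  × (∀ s (y : Structure.car B s) → ∃[ x ] BF Σ α A B (x ∷ a) (y ∷ b))
BF Σ (olim I _ f) A B a b = ∀ i → BF Σ (f i) A B a b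

record Language : Set₁ where
  field
    FunL : ℕ → Set
    RelL : ℕ → Set

allToVec : ∀ {S : Set} {P : S → Set} {s : S} (ss : List S)
         → (∀ {t} → t ∈ ss → t ≡ s) → All P ss → Vec (P s) (length ss)
allToVec [] _ [] = []
allToVec (t ∷ ss) h (x ∷ xs) with h (here refl)
... | refl = x ∷ allToVec ss (λ p → h (there p)) xs

repToVec : ∀ {S : Set} {P : S → Set} {s : S} (n : ℕ)
         → All P (replicate n s) → Vec (P s) n
repToVec zero [] = []
repToVec (suc n) (x ∷ xs) = x ∷ repToVec n xs

vecToRep : ∀ {S : Set} {P : S → Set} {s : S} {n : ℕ}
         → Vec (P s) n → All P (replicate n s)
vecToRep [] = []
vecToRep (x ∷ xs) = x ∷ vecToRep xs

module _ (L : Language) where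
  open Language L

  record OneStructure : Set₁ where
    field
      M    : Set
      funM : ∀ {n} → FunL n → Vec M n → M
      relM : ∀ {n} → RelL n → Vec M n → Set

  sigL : Signature
  sigL = record
    { Sort = ⊤
    ; Fun  = λ ss _ → FunL (length ss)
    ; Rel  = λ ss → RelL (length ss)
    }

  asStructure : OneStructure → Structure sigL
  asStructure 𝕄 = record
    { car = λ _ → M
    ; eqv = _≡_
    ; fun = λ {ss} f xs → funM f (allToVec ss (λ _ → refl) xs)
    ; rel = λ {ss} r xs → relM r (allToVec ss (λ _ → refl) xs)
    }
    where open OneStructure 𝕄

  QFRel : (𝕄 : OneStructure) → QF sigL (tt ∷ tt ∷ [])
        → OneStructure.M 𝕄 → OneStructure.M 𝕄 → Set
  QFRel 𝕄 φ x y = Sem.Sat sigL (asStructure 𝕄) φ (x ∷ y ∷ [])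

  -- The expansion M^𝓔 for a family 𝓔 = (E_e)_{e : I} of quantifier-free
  -- definable equivalence relations, E_e defined by φ e.

  data SortE (I : Set) : Set where
    home : SortE I
    quot : I → SortE I

  data FunE (I : Set) : List (SortE I) → SortE I → Set where
    old  : ∀ {n} → FunL n → FunE I (replicate n home) home
    proj : (e : I) → FunE I (home ∷ []) (quot e)

  data RelE (I : Set) : List (SortE I) → Set where
    oldR : ∀ {n} → RelL n → RelE I (replicate n home)

  sigE : Set → Signature
  sigE I = record { Sort = SortE I ; Fun = FunE I ; Rel = RelE I }

  module _ (𝕄 : OneStructure) (I : Set) (φ : I → QF sigL (tt ∷ tt ∷ [])) where
    open OneStructure 𝕄

    -- U_{E_e} is M/E_e, represented as the carrier M with equality E_e
    carE : SortE I → Set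
    carE home = M
    carE (quot e) = M

    eqvE : ∀ {s} → carE s → carE s → Set
    eqvE {home} = _≡_
    eqvE {quot e} = QFRel 𝕄 (φ e)

    funE : ∀ {ss s} → FunE I ss s → All carE ss → carE s
    funE (old {n} f) xs = funM f (repToVec n xs)
    funE (proj e) (x ∷ []) = x

    relE : ∀ {ss} → RelE I ss → All carE ss → Set
    relE (oldR {n} r) xs = relM r (repToVec n xs)

    expansion : Structure (sigE I)
    expansion = record { car = carE ; eqv = λ {s} → eqvE {s} ; fun = funE ; rel = relE }

{-# OPTIONS --safe #-}
module Submission where

-- Quantifier-free formulas of M and of M^𝓔 translate into each other: an L-formula is an
-- M^𝓔-formula on the home sort, and dropping π_E and replacing an equation t = u of sort U_E
-- by φ_E(t, u) turns an M^𝓔-formula into an L-formula with the same meaning. Since every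
-- element of U_E is π_E of an element of M, a move in the back-and-forth game on either side
-- can be answered by a move on the other, so ≡_α transfers both ways by induction on α.

open import Defs
open import Data.Nat using (ℕ; zero; suc)
open import Data.Unit using (tt)
open import Data.Empty using (⊥)
open import Data.Product using (_×_; _,_; ∃-syntax)
open import Data.Sum using (_⊎_)
open import Data.List using (List; []; _∷_; length; replicate)
open import Data.List.Properties using (length-replicate)
open import Data.List.Membership.Propositional using (_∈_)
open import Data.List.Relation.Unary.All using ([]; _∷_)
open import Data.List.Relation.Unary.Any using (here; there)
open import Data.Vec using (Vec; []; _∷_; cast)
open import Data.Vec.Properties using (cast-is-id)
open import Data.Vec.Relation.Binary.Pointwise.Inductive as Pointwise using (Pointwise; []; _∷_)
open import Function using (_∘_)
open import Relation.Binary.PropositionalEquality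
  using (_≡_; refl; cong; cong₂; subst; subst₂; sym; trans)
open import Relation.Binary.Structures using (IsEquivalence)
open import Function.Bundles using (_⇔_; mk⇔)

app-subst-cast : ∀ {a p x} {A : Set a} {P : ℕ → Set p} {X : Set x}
  (g : ∀ {n} → P n → Vec A n → X) {m n} (e : m ≡ n) (f : P n) (v : Vec A m)
  → g (subst P (sym e) f) v ≡ g f (cast e v)
app-subst-cast g refl f v = cong (g f) (sym (cast-is-id refl v))

module _ {Σ₁ Σ₂ : Signature} where

  replaceAtoms : ∀ {Δ Γ} → (Atomic Σ₂ Γ → QF Σ₁ Δ) → QF Σ₂ Γ → QF Σ₁ Δ
  replaceAtoms f (atom a)   = f a
  replaceAtoms f (neg ψ)    = neg (replaceAtoms f ψ)
  replaceAtoms f (conj ψ χ) = conj (replaceAtoms f ψ) (replaceAtoms f χ)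
  replaceAtoms f (disj ψ χ) = disj (replaceAtoms f ψ) (replaceAtoms f χ)

  sat-replaceAtoms : (A : Structure Σ₁) (B : Structure Σ₂)
    → ∀ {Δ Γ} {ρ₁ : Env Σ₁ A Δ} {ρ : Env Σ₂ B Γ}
      {f : Atomic Σ₂ Γ → QF Σ₁ Δ}
    → (∀ a → Sem.Sat Σ₁ A (f a) ρ₁ ≡ Sem.SatA Σ₂ B a ρ)
    → ∀ ψ → Sem.Sat Σ₁ A (replaceAtoms f ψ) ρ₁ ≡ Sem.Sat Σ₂ B ψ ρ
  sat-replaceAtoms A B sat (atom a)   = sat a
  sat-replaceAtoms A B sat (neg ψ)    = cong (λ X → X → ⊥) (sat-replaceAtoms A B sat ψ)
  sat-replaceAtoms A B sat (conj ψ χ) =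
    cong₂ _×_ (sat-replaceAtoms A B sat ψ) (sat-replaceAtoms A B sat χ)
  sat-replaceAtoms A B sat (disj ψ χ) =
    cong₂ _⊎_ (sat-replaceAtoms A B sat ψ) (sat-replaceAtoms A B sat χ)

module Substitution {Σ : Signature} where

  lookupTerms : ∀ {Γ Γ' s} → Terms Σ Γ Γ' → s ∈ Γ' → Term Σ Γ s
  lookupTerms (t ∷ _)  (here refl) = t
  lookupTerms (_ ∷ ts) (there p)   = lookupTerms ts p

  mutual
    substTerm : ∀ {Γ Γ' s} → Terms Σ Γ Γ' → Term Σ Γ' s → Term Σ Γ s
    substTerm us (var p)    = lookupTerms us p
    substTerm us (app f ts) = app f (substTerms us ts)

    substTerms : ∀ {Γ Γ' ss} → Terms Σ Γ Γ' → Terms Σ Γ' ss → Terms Σ Γ ss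
    substTerms us []       = []
    substTerms us (t ∷ ts) = substTerm us t ∷ substTerms us ts

  substAtomic : ∀ {Γ Γ'} → Terms Σ Γ Γ' → Atomic Σ Γ' → Atomic Σ Γ
  substAtomic us (equ t u) = equ (substTerm us t) (substTerm us u)
  substAtomic us (rl r ts) = rl r (substTerms us ts)

  substQF : ∀ {Γ Γ'} → Terms Σ Γ Γ' → QF Σ Γ' → QF Σ Γ
  substQF us = replaceAtoms (atom ∘ substAtomic us)

  module _ (A : Structure Σ) where
    open Structure A
    open Sem Σ A

    eval-lookupTerms : ∀ {Γ Γ' s} (us : Terms Σ Γ Γ') (p : s ∈ Γ') (ρ : Env Σ A Γ)
      → eval (lookupTerms us p) ρ ≡ lookupEnv (evals us ρ) p
    eval-lookupTerms (_ ∷ _)  (here refl) ρ = refl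
    eval-lookupTerms (_ ∷ us) (there p)   ρ = eval-lookupTerms us p ρ

    mutual
      eval-substTerm : ∀ {Γ Γ' s} (us : Terms Σ Γ Γ') (t : Term Σ Γ' s) (ρ : Env Σ A Γ)
        → eval (substTerm us t) ρ ≡ eval t (evals us ρ)
      eval-substTerm us (var p)    ρ = eval-lookupTerms us p ρ
      eval-substTerm us (app f ts) ρ = cong (fun f) (evals-substTerms us ts ρ)

      evals-substTerms : ∀ {Γ Γ' ss}
        (us : Terms Σ Γ Γ') (ts : Terms Σ Γ' ss) (ρ : Env Σ A Γ)
        → evals (substTerms us ts) ρ ≡ evals ts (evals us ρ)
      evals-substTerms us []       ρ = refl
      evals-substTerms us (t ∷ ts) ρ =
        cong₂ _∷_ (eval-substTerm us t ρ) (evals-substTerms us ts ρ)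

    satA-substAtomic : ∀ {Γ Γ'} (us : Terms Σ Γ Γ') (a : Atomic Σ Γ') (ρ : Env Σ A Γ)
      → SatA (substAtomic us a) ρ ≡ SatA a (evals us ρ)
    satA-substAtomic us (equ t u) ρ = cong₂ eqv (eval-substTerm us t ρ) (eval-substTerm us u ρ)
    satA-substAtomic us (rl r ts) ρ = cong (rel r) (evals-substTerms us ts ρ)

    sat-substQF : ∀ {Γ Γ'} (us : Terms Σ Γ Γ') (ψ : QF Σ Γ') (ρ : Env Σ A Γ)
      → Sat (substQF us ψ) ρ ≡ Sat ψ (evals us ρ)
    sat-substQF us ψ ρ = sat-replaceAtoms A A (λ a → satA-substAtomic us a ρ) ψ

open Substitution

module SortTranslation {Σ₁ Σ₂ : Signature}
                       (σ : Signature.Sort Σ₂ → Signature.Sort Σ₁) where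
  open Signature using (Sort)
  open Structure using (car)

  infix 4 _◁_
  data _◁_ : List (Sort Σ₁) → List (Sort Σ₂) → Set where
    []  : [] ◁ []
    _∷_ : ∀ {Δ Γ} s → Δ ◁ Γ → σ s ∷ Δ ◁ s ∷ Γ

  lift∈ : ∀ {Δ Γ s} → Δ ◁ Γ → s ∈ Γ → σ s ∈ Δ
  lift∈ (_ ∷ _) (here refl) = here refl
  lift∈ (_ ∷ k) (there p)   = there (lift∈ k p)

  replicate◁ : ∀ {s} n → replicate n (σ s) ◁ replicate n s
  replicate◁ zero    = []
  replicate◁ (suc n) = _ ∷ replicate◁ n

  Translation : Set
  Translation = ∀ {Δ Γ} → Δ ◁ Γ → QF Σ₂ Γ → QF Σ₁ Δ

  record Correspondence (A : Structure Σ₁) (B : Structure Σ₂) : Set₁ where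
    field
      _∼_         : ∀ {s} → car A (σ s) → car B s → Set
      left-total  : ∀ {s} (x₁ : car A (σ s)) → ∃[ x ] x₁ ∼ x
      right-total : ∀ {s} (x : car B s) → ∃[ x₁ ] x₁ ∼ x

  module _ {A : Structure Σ₁} {B : Structure Σ₂} (R : Correspondence A B) where
    open Correspondence R

    data EnvCorr : ∀ {Δ Γ} → Δ ◁ Γ → Env Σ₁ A Δ → Env Σ₂ B Γ → Set where
      []  : EnvCorr [] [] []
      _∷_ : ∀ {Δ Γ s} {k : Δ ◁ Γ} {x₁ x ρ₁ ρ}
          → x₁ ∼ x → EnvCorr k ρ₁ ρ → EnvCorr (s ∷ k) (x₁ ∷ ρ₁) (x ∷ ρ)

    lookup-envCorr : ∀ {Δ Γ s} {k : Δ ◁ Γ} {ρ₁ ρ}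
      → EnvCorr k ρ₁ ρ → (p : s ∈ Γ)
      → Sem.lookupEnv Σ₁ A ρ₁ (lift∈ k p) ∼ Sem.lookupEnv Σ₂ B ρ p
    lookup-envCorr (x₁∼x ∷ _) (here refl) = x₁∼x
    lookup-envCorr (_ ∷ c)    (there p)   = lookup-envCorr c p

    envCorr-vecToRep : ∀ {s n} {u : Vec (car A (σ s)) n} {v : Vec (car B s) n}
      → Pointwise _∼_ u v → EnvCorr (replicate◁ n) (vecToRep u) (vecToRep v)
    envCorr-vecToRep []         = []
    envCorr-vecToRep (x₁∼x ∷ c) = x₁∼x ∷ envCorr-vecToRep c

    SatPreserving : Translation → Set₁
    SatPreserving tr = ∀ {Δ Γ} {k : Δ ◁ Γ} {ρ₁ ρ}
      → EnvCorr k ρ₁ ρ → (ψ : QF Σ₂ Γ)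
      → Sem.Sat Σ₁ A (tr k ψ) ρ₁ ≡ Sem.Sat Σ₂ B ψ ρ

  open Correspondence using (left-total; right-total)

  bf-transfer : ∀ {A A' B B'} {R : Correspondence A B} {R' : Correspondence A' B'}
    (tr : Translation) → SatPreserving R tr → SatPreserving R' tr
    → ∀ α {Δ Γ} {k : Δ ◁ Γ} {a₁ b₁ a b}
    → EnvCorr R k a₁ a → EnvCorr R' k b₁ b
    → BF Σ₁ α A A' a₁ b₁ → BF Σ₂ α B B' a b
  bf-transfer tr sat sat' ozero ca cb h ψ = subst₂ _⇔_ (sat ca ψ) (sat' cb ψ) (h (tr _ ψ))
  bf-transfer {B = B} {B'} {R} {R'} tr sat sat' (osuc α) {a = a} {b} ca cb (forth , back) =
    forth′ , back′
    where
    forth′ : ∀ s (x : car B s) → ∃[ y ] BF Σ₂ α B B' (x ∷ a) (y ∷ b)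
    forth′ s x =
      let (x₁ , x₁∼x) = right-total R x
          (y₁ , h)    = forth (σ s) x₁
          (y , y₁∼y)  = left-total R' y₁
      in y , bf-transfer tr sat sat' α (x₁∼x ∷ ca) (y₁∼y ∷ cb) h

    back′ : ∀ s (y : car B' s) → ∃[ x ] BF Σ₂ α B B' (x ∷ a) (y ∷ b)
    back′ s y =
      let (y₁ , y₁∼y) = right-total R' y
          (x₁ , h)    = back (σ s) y₁
          (x , x₁∼x)  = left-total R x₁
      in x , bf-transfer tr sat sat' α (x₁∼x ∷ ca) (y₁∼y ∷ cb) h
  bf-transfer tr sat sat' (olim _ _ f) ca cb h i = bf-transfer tr sat sat' (f i) ca cb (h i)

module Expansion (L : Language) (𝕄 : OneStructure L) (I : Set)
                 (φ : I → QF (sigL L) (tt ∷ tt ∷ [])) where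
  open Language L
  open OneStructure 𝕄

  private
    ΣL = sigL L
    ΣE = sigE L I
    ML = asStructure L 𝕄
    ME = expansion L 𝕄 I φ
    module SemL = Sem ΣL ML
    module SemE = Sem ΣE ME

  module Embedding where
    open SortTranslation {ΣE} {ΣL} (λ _ → home)

    mutual
      embedTerm : ∀ {Δ Γ s} → Δ ◁ Γ → Term ΣL Γ s → Term ΣE Δ home
      embedTerm k (var p)         = var (lift∈ k p)
      embedTerm k (app {ss} f ts) = app (old {n = length ss} f) (embedTerms k ts)

      embedTerms : ∀ {Δ Γ ss} → Δ ◁ Γ
        → Terms ΣL Γ ss → Terms ΣE Δ (replicate (length ss) home)
      embedTerms k []       = []
      embedTerms k (t ∷ ts) = embedTerm k t ∷ embedTerms k ts

    embedAtomic : ∀ {Δ Γ} → Δ ◁ Γ → Atomic ΣL Γ → QF ΣE Δ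
    embedAtomic k (equ t u)      = atom (equ (embedTerm k t) (embedTerm k u))
    embedAtomic k (rl {ss} r ts) = atom (rl (oldR {n = length ss} r) (embedTerms k ts))

    embedQF : Translation
    embedQF k = replaceAtoms (embedAtomic k)

    identity : Correspondence ME ML
    identity = record
      { _∼_         = λ {s} → _≡_
      ; left-total  = λ x → x , refl
      ; right-total = λ x → x , refl
      }

    module _ {Δ Γ} {k : Δ ◁ Γ} {ρ₁ ρ} (c : EnvCorr identity k ρ₁ ρ) where
      mutual
        eval-embedTerm : ∀ {s} (t : Term ΣL Γ s)
          → SemE.eval (embedTerm k t) ρ₁ ≡ SemL.eval t ρ
        eval-embedTerm (var p)    = lookup-envCorr identity c p
        eval-embedTerm (app f ts) = cong (funM f) (evals-embedTerms ts)

        evals-embedTerms : ∀ {ss} (ts : Terms ΣL Γ ss)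
          → repToVec (length ss) (SemE.evals (embedTerms k ts) ρ₁)
            ≡ allToVec ss (λ _ → refl) (SemL.evals ts ρ)
        evals-embedTerms []       = refl
        evals-embedTerms (t ∷ ts) = cong₂ _∷_ (eval-embedTerm t) (evals-embedTerms ts)

      sat-embedAtomic : ∀ a → SemE.Sat (embedAtomic k a) ρ₁ ≡ SemL.SatA a ρ
      sat-embedAtomic (equ t u) = cong₂ _≡_ (eval-embedTerm t) (eval-embedTerm u)
      sat-embedAtomic (rl r ts) = cong (relM r) (evals-embedTerms ts)

    sat-embedQF : SatPreserving identity embedQF
    sat-embedQF c = sat-replaceAtoms ME ML (sat-embedAtomic c)

    bf-from-expansion : ∀ α {n} (a b : Vec M n)
      → BF ΣE α ME ME (vecToRep a) (vecToRep b) → BF ΣL α ML ML (vecToRep a) (vecToRep b)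
    bf-from-expansion α a b = bf-transfer embedQF sat-embedQF sat-embedQF α
      (envCorr-vecToRep identity (Pointwise.refl refl))
      (envCorr-vecToRep identity (Pointwise.refl refl))

  module Collapse where
    open SortTranslation {ΣL} {ΣE} (λ _ → tt)

    mutual
      collapseTerm : ∀ {Δ Γ s} → Δ ◁ Γ → Term ΣE Γ s → Term ΣL Δ tt
      collapseTerm k (var p) = var (lift∈ k p)
      -- sigL indexes a symbol by the length of its sort list, and
      -- length (replicate n tt) is n only propositionally.
      collapseTerm k (app (old {n} f) ts) =
        app {ss = replicate n tt} (subst FunL (sym (length-replicate n)) f) (collapseTerms k n ts)
      collapseTerm k (app (proj e) (t ∷ [])) = collapseTerm k t

      collapseTerms : ∀ {Δ Γ} → Δ ◁ Γ
        → ∀ n → Terms ΣE Γ (replicate n home) → Terms ΣL Δ (replicate n tt)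
      collapseTerms k zero    []       = []
      collapseTerms k (suc n) (t ∷ ts) = collapseTerm k t ∷ collapseTerms k n ts

    collapseAtomic : ∀ {Δ Γ} → Δ ◁ Γ → Atomic ΣE Γ → QF ΣL Δ
    collapseAtomic k (equ {home}   t u) = atom (equ (collapseTerm k t) (collapseTerm k u))
    collapseAtomic k (equ {quot e} t u) =
      substQF (collapseTerm k t ∷ collapseTerm k u ∷ []) (φ e)
    collapseAtomic k (rl (oldR {n} r) ts) =
      atom (rl {ss = replicate n tt} (subst RelL (sym (length-replicate n)) r)
               (collapseTerms k n ts))

    collapseQF : Translation
    collapseQF k = replaceAtoms (collapseAtomic k)

    Represents : ∀ s → M → carE L 𝕄 I φ s → Set
    Represents home     = _≡_
    Represents (quot _) = _≡_

    representatives : Correspondence ML ME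
    representatives = record
      { _∼_         = λ {s} → Represents s
      ; left-total  = λ { {home} x → x , refl ; {quot _} x → x , refl }
      ; right-total = λ { {home} x → x , refl ; {quot _} x → x , refl }
      }

    module _ {Δ Γ} {k : Δ ◁ Γ} {ρ₁ ρ} (c : EnvCorr representatives k ρ₁ ρ) where
      mutual
        eval-collapseTerm : ∀ {s} (t : Term ΣE Γ s)
          → Represents s (SemL.eval (collapseTerm k t) ρ₁) (SemE.eval t ρ)
        eval-collapseTerm (var p) = lookup-envCorr representatives c p
        eval-collapseTerm (app (old {n} f) ts) =
          trans (app-subst-cast funM (length-replicate n) f _)
                (cong (funM f) (evals-collapseTerms n ts))
        eval-collapseTerm (app (proj e) (t ∷ [])) = eval-collapseTerm t

        evals-collapseTerms : ∀ n (ts : Terms ΣE Γ (replicate n home))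
          → cast (length-replicate n)
              (allToVec (replicate n tt) (λ _ → refl) (SemL.evals (collapseTerms k n ts) ρ₁))
            ≡ repToVec n (SemE.evals ts ρ)
        evals-collapseTerms zero    []       = refl
        evals-collapseTerms (suc n) (t ∷ ts) =
          cong₂ _∷_ (eval-collapseTerm t) (evals-collapseTerms n ts)

      sat-collapseAtomic : ∀ a → SemL.Sat (collapseAtomic k a) ρ₁ ≡ SemE.SatA a ρ
      sat-collapseAtomic (equ {home} t u) =
        cong₂ _≡_ (eval-collapseTerm t) (eval-collapseTerm u)
      sat-collapseAtomic (equ {quot e} t u) =
        trans (sat-substQF ML (collapseTerm k t ∷ collapseTerm k u ∷ []) (φ e) ρ₁)
              (cong₂ (QFRel L 𝕄 (φ e)) (eval-collapseTerm t) (eval-collapseTerm u))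
      sat-collapseAtomic (rl (oldR {n} r) ts) =
        trans (app-subst-cast relM (length-replicate n) r _)
              (cong (relM r) (evals-collapseTerms n ts))

    sat-collapseQF : SatPreserving representatives collapseQF
    sat-collapseQF c = sat-replaceAtoms ML ME (sat-collapseAtomic c)

    bf-to-expansion : ∀ α {n} (a b : Vec M n)
      → BF ΣL α ML ML (vecToRep a) (vecToRep b) → BF ΣE α ME ME (vecToRep a) (vecToRep b)
    bf-to-expansion α a b = bf-transfer collapseQF sat-collapseQF sat-collapseQF α
      (envCorr-vecToRep representatives {s = home} (Pointwise.refl refl))
      (envCorr-vecToRep representatives {s = home} (Pointwise.refl refl))

mainTheorem18 : (L : Language) (𝕄 : OneStructure L) (I : Set)
    (φ : I → QF (sigL L) (tt ∷ tt ∷ []))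
    (isEqv : (e : I) → IsEquivalence (QFRel L 𝕄 (φ e)))
    (n : ℕ) (a b : Vec (OneStructure.M 𝕄) n) (α : Ord)
    → BF (sigL L) α (asStructure L 𝕄) (asStructure L 𝕄)
        (vecToRep {s = tt} a) (vecToRep {s = tt} b)
      ⇔ BF (sigE L I) α (expansion L 𝕄 I φ) (expansion L 𝕄 I φ)
        (vecToRep {s = home} a) (vecToRep {s = home} b)
-- The relations E need not be equivalences here: U_E is represented by M itself, with
-- φ_E interpreting its equality, so no quotient is ever formed.
mainTheorem18 L 𝕄 I φ _ n a b α =
  mk⇔ (Collapse.bf-to-expansion α a b) (Embedding.bf-from-expansion α a b)
  where open Expansion L 𝕄 I φ
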